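{- Let $\mathscr{M}=(S,\rho)$ be a matroid scheme. (1) If $x\in S$, $a\in\mathrm{at}(S)$ and $u\in x\vee a$, then $\rho(x)\le\rho(u)\le\rho(x)+1$. (2) If $T\subseteq S$ and $u,v\in\bigvee T$, then $\rho(u)=\rho(v)$. (3) $\rho$ is constant on the set of maximal elements of $S$.
   Context: A finite poset $S$ is a simplicial poset if it has a unique minimum $\hat0$, is ranked, and each $S_{\le x}$ is isomorphic to the Boolean lattice of subsets of the atoms (rank-one elements) below $x$; $|x|$ is the rank of $x$, $\mathrm{at}(S)$ the set of atoms. For $T\subseteq S$, $\bigvee T$ is the set of minimal common upper bounds of $T$ and $\bigwedge T$ the set of maximal common lower bounds; $x\vee y=\bigvee\{x,y\}$, $x\wedge y=\bigwedge\{x,y\}$ (a single element when $x\vee y\neq\emptyset$). A matroid scheme is $(S,\rho)$ with $\rho:S\to\mathbb{Z}_{\ge0}$ satisfying (M1) $0\le\rho(x)\le|x|$; (M2) $x\le y\Rightarrow\rho(x)\le\rho(y)$; (M3) $u\in x\vee y\Rightarrow\rho(x)+\rho(y)\ge\rho(u)+\rho(x\wedge y)$; (M4) $\ell\in x\wedge y$ and $\rho(x)=\rho(\ell)\Rightarrow x\vee y\neq\emptyset$; (M5) if $\rho(x)<\rho(y)$ there is $a\in\mathrm{at}(S)$ with $a\le y$, $a\not\le x$, $x\vee a\ne\emptyset$. -}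

module Defs where

open import Data.Nat using (ℕ; zero; suc; _+_; _≤_; _<_)
import Data.Nat as ℕ
open import Data.Fin using (Fin)
open import Data.Fin.Subset using (Subset; _∈_; _⊆_)
open import Data.Vec using (tabulate)
open import Data.Bool using (_∧_)
open import Data.Product using (Σ; ∃; _×_)
open import Data.Sum using (_⊎_)
open import Relation.Nullary using (¬_; Dec)
open import Relation.Nullary.Decidable using (⌊_⌋)
open import Relation.Binary.PropositionalEquality using (_≡_)
open import Relation.Binary.Structures using (IsDecPartialOrder)
open import Relation.Unary using (Pred)
open import Level using (0ℓ)

module Order {n : ℕ} (_⊑_ : Fin n → Fin n → Set) where

  _⊏_ : Fin n → Fin n → Set
  x ⊏ y = x ⊑ y × ¬ (x ≡ y)

  _⋖_ : Fin n → Fin n → Set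
  x ⋖ y = x ⊏ y × (∀ z → x ⊏ z → ¬ (z ⊏ y))

  IsUB : Pred (Fin n) 0ℓ → Fin n → Set
  IsUB T u = ∀ t → T t → t ⊑ u

  IsLB : Pred (Fin n) 0ℓ → Fin n → Set
  IsLB T l = ∀ t → T t → l ⊑ t

  InJoin : Pred (Fin n) 0ℓ → Fin n → Set
  InJoin T u = IsUB T u × (∀ w → IsUB T w → w ⊑ u → w ≡ u)

  InMeet : Pred (Fin n) 0ℓ → Fin n → Set
  InMeet T l = IsLB T l × (∀ w → IsLB T w → l ⊑ w → w ≡ l)

  pair : Fin n → Fin n → Pred (Fin n) 0ℓ
  pair x y t = t ≡ x ⊎ t ≡ y

  InJoin₂ : Fin n → Fin n → Fin n → Set
  InJoin₂ x y u = InJoin (pair x y) u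

  InMeet₂ : Fin n → Fin n → Fin n → Set
  InMeet₂ x y l = InMeet (pair x y) l

  IsMaximal : Fin n → Set
  IsMaximal m = ∀ y → m ⊑ y → y ≡ m

record SimplicialPoset (n : ℕ) : Set₁ where
  field
    _⊑_        : Fin n → Fin n → Set
    isDecPO    : IsDecPartialOrder _≡_ _⊑_
  open IsDecPartialOrder isDecPO public using () renaming (_≤?_ to _⊑?_)
  open Order _⊑_ public
  field
    bot        : Fin n
    bot-min    : ∀ x → bot ⊑ x
    rank       : Fin n → ℕ
    rank-bot   : rank bot ≡ 0
    rank-cover : ∀ x y → x ⋖ y → rank y ≡ suc (rank x)

  IsAtom : Fin n → Set
  IsAtom a = rank a ≡ 1

  atomsBelow : Fin n → Subset n
  atomsBelow x = tabulate (λ a → ⌊ rank a ℕ.≟ 1 ⌋ ∧ ⌊ a ⊑? x ⌋)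

  field
    -- S_{≤x} is isomorphic (as a poset) to the Boolean lattice of subsets
    -- of the atoms below x
    boolean : ∀ x → Σ ((y : Fin n) → y ⊑ x → Subset n) λ f →
                 (∀ y p → f y p ⊆ atomsBelow x)
               × (∀ y p z q → (y ⊑ z → f y p ⊆ f z q) × (f y p ⊆ f z q → y ⊑ z))
               × (∀ A → A ⊆ atomsBelow x → ∃ λ y → Σ (y ⊑ x) λ p → f y p ≡ A)

record MatroidScheme (n : ℕ) : Set₁ where
  field
    S : SimplicialPoset n
  open SimplicialPoset S public
  field
    ρ  : Fin n → ℕ
    M1 : ∀ x → ρ x ≤ rank x
    M2 : ∀ x y → x ⊑ y → ρ x ≤ ρ y
    M3 : ∀ x y u l → InJoin₂ x y u → InMeet₂ x y l → ρ u + ρ l ≤ ρ x + ρ y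
    M4 : ∀ x y l → InMeet₂ x y l → ρ x ≡ ρ l → ∃ λ u → InJoin₂ x y u
    M5 : ∀ x y → ρ x < ρ y →
           ∃ λ a → IsAtom a × a ⊑ y × ¬ (a ⊑ x) × (∃ λ u → InJoin₂ x a u)

-- (1) A maximal common lower bound ℓ of x and the atom a exists, and M3 gives
-- ρ u ≤ ρ u + ρ ℓ ≤ ρ x + ρ a ≤ ρ x + 1.
-- (2) Two minimal upper bounds u, v of T lie above the same atoms: if the atom
-- a ≤ v were not below u, then no t ∈ T lies above a, so every t ∈ T lies
-- below the complement c of a in the Boolean interval [0̂, v]; minimality of v
-- forces c = v, which is absurd. By M5 an element cannot have smaller rank
-- than another one whose atoms it contains, so ρ u = ρ v.
-- (3) If ρ m < ρ y, M5 yields an atom a ≰ m with m ∨ a ≠ ∅, so m is not maximal.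
module Submission where

open import Defs
open import Data.Nat using (ℕ; suc; _≤_; _<_; _+_)
open import Data.Nat.Properties
  using (≤-antisym; ≮⇒≥; ≤⇒≯; <-trans; m≤m+n; +-monoʳ-≤; +-comm; n<1+n; 1+n≢0; module ≤-Reasoning)
open import Data.Fin using (Fin; _≟_)
open import Data.Fin.Properties using (any?)
open import Data.Fin.Subset using (Subset; _∈_; _∉_; _⊆_; _∩_; ∁; ⊥)
open import Data.Fin.Subset.Properties using (x∈p∩q⁺; x∈p∩q⁻; x∈p⇒x∉∁p; x∉p⇒x∈∁p; ⊥⊆; ∉⊥)
open import Data.Fin.Induction using (po-wellFounded; po-noetherian)
open import Data.Product using (Σ; ∃; _×_; _,_; proj₁; proj₂)
open import Data.Sum using (inj₁; inj₂)
open import Data.Empty using (⊥-elim)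
open import Function using (flip; _∘_)
open import Induction.WellFounded using (Acc; acc)
open import Level using (0ℓ)
open import Relation.Binary.Core using (Rel)
open import Relation.Binary.Definitions using (Decidable)
open import Relation.Binary.PropositionalEquality using (_≡_; refl; sym; trans; subst)
open import Relation.Binary.Structures using (IsDecPartialOrder)
open import Relation.Nullary using (¬_; Dec; yes; no; contradiction)
open import Relation.Nullary.Decidable using (_×-dec_; ¬?; decidable-stable)
open import Relation.Unary using (Pred) renaming (Decidable to Decidable₁)

∃-minimal : ∀ {n} {_<ᵣ_ : Rel (Fin n) 0ℓ} → Decidable _<ᵣ_ →
            {P : Pred (Fin n) 0ℓ} → Decidable₁ P →
            ∀ {x} → Acc _<ᵣ_ x → P x → ∃ λ m → P m × (∀ z → P z → ¬ z <ᵣ m)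
∃-minimal _<?_ P? {x} (acc rs) px with any? (λ z → P? z ×-dec (z <? x))
... | yes (z , pz , z<x) = ∃-minimal _<?_ P? (rs z<x) pz
... | no ∄z             = x , px , λ z pz z<x → ∄z (z , pz , z<x)

module SimplicialPosetProperties {n : ℕ} (S : SimplicialPoset n) where
  open SimplicialPoset S
  open IsDecPartialOrder isDecPO
    using (isPartialOrder) renaming (refl to ⊑-refl; trans to ⊑-trans; antisym to ⊑-antisym)

  _⊏?_ : Decidable _⊏_
  x ⊏? y = (x ⊑? y) ×-dec ¬? (x ≟ y)

  ⊑∧≢⇒⊏ : ∀ {x y} → x ⊑ y → ¬ y ≡ x → x ⊏ y
  ⊑∧≢⇒⊏ x⊑y y≢x = x⊑y , y≢x ∘ sym

  InMeet₂-exists : ∀ x y → ∃ (InMeet₂ x y)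
  InMeet₂-exists x y
    with ∃-minimal (flip _⊏?_) (λ w → (w ⊑? x) ×-dec (w ⊑? y))
                   (po-noetherian isPartialOrder bot) (bot-min x , bot-min y)
  ... | m , (m⊑x , m⊑y) , m-max = m , isLB , maximal
    where
      isLB : IsLB (pair x y) m
      isLB t (inj₁ refl) = m⊑x
      isLB t (inj₂ refl) = m⊑y

      maximal : ∀ w → IsLB (pair x y) w → m ⊑ w → w ≡ m
      maximal w w-lb m⊑w with w ≟ m
      ... | yes w≡m = w≡m
      ... | no  w≢m = contradiction (⊑∧≢⇒⊏ m⊑w w≢m)
                        (m-max w (w-lb x (inj₁ refl) , w-lb y (inj₂ refl)))

  -- A minimal element m of the half-open interval (w, a] covers w.
  rank-strictMono : ∀ {w a} → w ⊏ a → rank w < rank a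
  rank-strictMono {w} = go (po-noetherian isPartialOrder w)
    where
      go : ∀ {w a} → Acc (flip _⊏_) w → w ⊏ a → rank w < rank a
      go {w} {a} (acc rs) w⊏a
        with ∃-minimal _⊏?_ (λ z → (w ⊏? z) ×-dec (z ⊑? a))
                       (po-wellFounded isPartialOrder a) (w⊏a , ⊑-refl)
      ... | m , (w⊏m , m⊑a) , m-min = step (m ≟ a)
        where
          w⋖m : w ⋖ m
          w⋖m = w⊏m , λ z w⊏z z⊏m → m-min z (w⊏z , ⊑-trans (proj₁ z⊏m) m⊑a) z⊏m

          w<m : rank w < rank m
          w<m = subst (rank w <_) (sym (rank-cover w m w⋖m)) (n<1+n (rank w))

          step : Dec (m ≡ a) → rank w < rank a
          step (yes m≡a) = subst (λ z → rank w < rank z) m≡a w<m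
          step (no  m≢a) = <-trans w<m (go (rs w⊏m) (m⊑a , m≢a))

  atom≢bot : ∀ {a} → IsAtom a → ¬ a ≡ bot
  atom≢bot rank-a refl = 1+n≢0 (trans (sym rank-a) rank-bot)

  ⊏-atom⇒≡bot : ∀ {g a} → IsAtom a → g ⊏ a → g ≡ bot
  ⊏-atom⇒≡bot {g} {a} rank-a g⊏a with g ≟ bot
  ... | yes g≡bot = g≡bot
  ... | no  g≢bot = contradiction (subst (rank g <_) rank-a (rank-strictMono g⊏a)) (≤⇒≯ 1≤g)
    where
      1≤g : 1 ≤ rank g
      1≤g = subst (λ k → suc k ≤ rank g) rank-bot (rank-strictMono (⊑∧≢⇒⊏ (bot-min g) g≢bot))

  module BooleanInterval (v : Fin n) where
    φ : ∀ y → y ⊑ v → Subset n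
    φ = proj₁ (boolean v)

    φ-mono : ∀ {y z} (p : y ⊑ v) (q : z ⊑ v) → y ⊑ z → φ y p ⊆ φ z q
    φ-mono {y} {z} p q = proj₁ (proj₁ (proj₂ (proj₂ (boolean v))) y p z q)

    φ-reflect : ∀ {y z} (p : y ⊑ v) (q : z ⊑ v) → φ y p ⊆ φ z q → y ⊑ z
    φ-reflect {y} {z} p q = proj₂ (proj₁ (proj₂ (proj₂ (boolean v))) y p z q)

    φ-onto : ∀ {y} (p : y ⊑ v) (A : Subset n) → A ⊆ φ y p → ∃ λ z → Σ (z ⊑ v) λ q → φ z q ≡ A
    φ-onto {y} p A A⊆φy = proj₂ (proj₂ (proj₂ (boolean v))) A (proj₁ (proj₂ (boolean v)) y p ∘ A⊆φy)

    φ-bot : ∀ {i} → i ∉ φ bot (bot-min v)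
    φ-bot {i} i∈φbot with φ-onto ⊑-refl ⊥ ⊥⊆
    ... | e , e⊑v , φe≡⊥ = ∉⊥ (subst (i ∈_) φe≡⊥ (φ-mono (bot-min v) e⊑v (bot-min e) i∈φbot))

    -- The meet of t and a corresponds to φ t ∩ φ a; it lies strictly below
    -- the atom a, hence is 0̂, whose image is empty.
    φ-disjoint : ∀ {a t} (a⊑v : a ⊑ v) (t⊑v : t ⊑ v) → IsAtom a → ¬ a ⊑ t →
                 ∀ {i} → i ∈ φ t t⊑v → i ∉ φ a a⊑v
    φ-disjoint {a} {t} a⊑v t⊑v rank-a a⋢t {i} i∈φt i∈φa
      with φ-onto t⊑v (φ t t⊑v ∩ φ a a⊑v) (proj₁ ∘ x∈p∩q⁻ _ _)
    ... | g , g⊑v , φg≡ = φ-bot (φ-mono g⊑v (bot-min v) g⊑bot i∈φg)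
      where
        below : ∀ {j} → j ∈ φ g g⊑v → j ∈ φ t t⊑v × j ∈ φ a a⊑v
        below = x∈p∩q⁻ _ _ ∘ subst (_ ∈_) φg≡

        g⊑t : g ⊑ t
        g⊑t = φ-reflect g⊑v t⊑v (proj₁ ∘ below)

        g⊑a : g ⊑ a
        g⊑a = φ-reflect g⊑v a⊑v (proj₂ ∘ below)

        g⊑bot : g ⊑ bot
        g⊑bot = subst (g ⊑_) (⊏-atom⇒≡bot rank-a (⊑∧≢⇒⊏ g⊑a (λ { refl → a⋢t g⊑t }))) ⊑-refl

        i∈φg : i ∈ φ g g⊑v
        i∈φg = subst (i ∈_) (sym φg≡) (x∈p∩q⁺ (i∈φt , i∈φa))

    -- The complement c is the element with φ c = φ v ∖ φ a.
    atom-complement : ∀ {a} → IsAtom a → a ⊑ v →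
                      ∃ λ c → c ⊑ v × ¬ a ⊑ c × (∀ t → t ⊑ v → ¬ a ⊑ t → t ⊑ c)
    atom-complement {a} rank-a a⊑v
      with φ-onto ⊑-refl (φ v ⊑-refl ∩ ∁ (φ a a⊑v)) (proj₁ ∘ x∈p∩q⁻ _ _)
    ... | c , c⊑v , φc≡ = c , c⊑v , a⋢c , below-c
      where
        φc⁻ : ∀ {i} → i ∈ φ c c⊑v → i ∈ φ v ⊑-refl × i ∈ ∁ (φ a a⊑v)
        φc⁻ = x∈p∩q⁻ _ _ ∘ subst (_ ∈_) φc≡

        a⋢c : ¬ a ⊑ c
        a⋢c a⊑c = atom≢bot rank-a (⊑-antisym a⊑bot (bot-min a))
          where
            a⊑bot : a ⊑ bot
            a⊑bot = φ-reflect a⊑v (bot-min v) λ i∈φa →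
                      ⊥-elim (x∈p⇒x∉∁p i∈φa (proj₂ (φc⁻ (φ-mono a⊑v c⊑v a⊑c i∈φa))))

        below-c : ∀ t → t ⊑ v → ¬ a ⊑ t → t ⊑ c
        below-c t t⊑v a⋢t = φ-reflect t⊑v c⊑v λ {i} i∈φt →
          subst (i ∈_) (sym φc≡)
            (x∈p∩q⁺ (φ-mono t⊑v ⊑-refl t⊑v i∈φt , x∉p⇒x∈∁p (φ-disjoint a⊑v t⊑v rank-a a⋢t i∈φt)))

  open BooleanInterval using (atom-complement)

  InJoin-atoms : ∀ {T : Pred (Fin n) 0ℓ} {u v a} → InJoin T u → InJoin T v →
                 IsAtom a → a ⊑ v → a ⊑ u
  InJoin-atoms {T} {u} {v} {a} (u-ub , _) (v-ub , v-min) rank-a a⊑v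
    with atom-complement v rank-a a⊑v
  ... | c , c⊑v , a⋢c , below-c =
    decidable-stable (a ⊑? u) λ a⋢u → a⋢c (subst (a ⊑_) (sym (c≡v a⋢u)) a⊑v)
    where
      c≡v : ¬ a ⊑ u → c ≡ v
      c≡v a⋢u = v-min c (λ t t∈T → below-c t (v-ub t t∈T) λ a⊑t → a⋢u (⊑-trans a⊑t (u-ub t t∈T)))
                      c⊑v

module MatroidSchemeProperties {n : ℕ} (M : MatroidScheme n) where
  open MatroidScheme M
  open SimplicialPosetProperties S using (InMeet₂-exists; InJoin-atoms)

  ρ-join-atom : ∀ {x a u} → IsAtom a → InJoin₂ x a u → ρ x ≤ ρ u × ρ u ≤ suc (ρ x)
  ρ-join-atom {x} {a} {u} rank-a u∈x∨a@(u-ub , _) with InMeet₂-exists x a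
  ... | ℓ , ℓ∈x∧a = M2 x u (u-ub x (inj₁ refl)) , ρu≤1+ρx
    where
      open ≤-Reasoning
      ρu≤1+ρx : ρ u ≤ suc (ρ x)
      ρu≤1+ρx = begin
        ρ u          ≤⟨ m≤m+n (ρ u) (ρ ℓ) ⟩
        ρ u + ρ ℓ    ≤⟨ M3 x a u ℓ u∈x∨a ℓ∈x∧a ⟩
        ρ x + ρ a    ≤⟨ +-monoʳ-≤ (ρ x) (subst (ρ a ≤_) rank-a (M1 a)) ⟩
        ρ x + 1      ≡⟨ +-comm (ρ x) 1 ⟩
        suc (ρ x)    ∎

  atoms⊑⇒ρ≤ : ∀ {x y} → (∀ a → IsAtom a → a ⊑ y → a ⊑ x) → ρ y ≤ ρ x
  atoms⊑⇒ρ≤ {x} {y} atoms⊑ = ≮⇒≥ λ ρx<ρy →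
    let a , rank-a , a⊑y , a⋢x , _ = M5 x y ρx<ρy in a⋢x (atoms⊑ a rank-a a⊑y)

  ρ-InJoin-unique : ∀ {T : Pred (Fin n) 0ℓ} {u v} → InJoin T u → InJoin T v → ρ u ≡ ρ v
  ρ-InJoin-unique ju jv =
    ≤-antisym (atoms⊑⇒ρ≤ λ _ rank-a → InJoin-atoms jv ju rank-a)
              (atoms⊑⇒ρ≤ λ _ rank-a → InJoin-atoms ju jv rank-a)

  maximal⇒ρ-max : ∀ {m} → IsMaximal m → ∀ y → ρ y ≤ ρ m
  maximal⇒ρ-max {m} m-max y = ≮⇒≥ λ ρm<ρy →
    let a , _ , _ , a⋢m , u , (u-ub , _) = M5 m y ρm<ρy
    in a⋢m (subst (a ⊑_) (m-max u (u-ub m (inj₁ refl))) (u-ub a (inj₂ refl)))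

proposition4p7 : ∀ (n : ℕ) (M : MatroidScheme n) → let open MatroidScheme M in
    (∀ x a u → IsAtom a → InJoin₂ x a u → ρ x ≤ ρ u × ρ u ≤ suc (ρ x))
    × (∀ (T : Subset n) u v → InJoin (_∈ T) u → InJoin (_∈ T) v → ρ u ≡ ρ v)
    × (∀ m m' → IsMaximal m → IsMaximal m' → ρ m ≡ ρ m')
proposition4p7 n M =
    (λ _ _ _ → ρ-join-atom)
  , (λ _ _ _ → ρ-InJoin-unique)
  , (λ m m' m-max m'-max → ≤-antisym (maximal⇒ρ-max m'-max m) (maximal⇒ρ-max m-max m'))
  where open MatroidSchemeProperties M
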